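{- Let $M=M(S_0,\dots,S_r)$ be the freedom matroid of a flag on $S$. A set $F\subseteq S$ is closed in $M$ if and only if $F=A\cup S_m$ for some $m\ge 0$ and some $A\subseteq S\setminus S_m$ with $|A\cap S_i|<i-m$ for all $i>m$; in that case the rank of $F$ is $m+|A|$.
   Context: A flag on a finite set $S$ is a sequence $(S_0,\dots,S_r)$ with $S_r=S$ and $S_{i-1}\subsetneq S_i$ for $1\le i\le r$. The freedom matroid $M(S_0,\dots,S_r)$ is the matroid on $S$ whose independent sets are the $I\subseteq S$ with $|I\cap S_i|\le i$ for all $i$. -}

module Defs where

open import Data.Bool using (Bool; true; false)
open import Data.Nat using (ℕ; zero; suc; _≤_; _<_; _⊔_; _≟_; _≤?_)
open import Data.Fin using (Fin; toℕ; fromℕ; inject₁)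
open import Data.Fin.Properties using (all?)
open import Data.Fin.Subset using (Subset; _∩_; _∪_; _⊆_; _⊂_; ⊤; ⁅_⁆; ∣_∣)
open import Data.Fin.Subset.Properties using (_⊆?_)
open import Data.List using (List; []; _∷_; _++_; map; filter; foldr)
open import Data.Vec using (Vec; []; _∷_; tabulate)
open import Data.Product using (_×_)
open import Relation.Nullary using (Dec; does)
open import Relation.Nullary.Decidable using (_×-dec_)
open import Relation.Binary.PropositionalEquality using (_≡_)

record IsFlag {n r : ℕ} (S : Fin (suc r) → Subset n) : Set where
  field
    top    : S (fromℕ r) ≡ ⊤
    strict : (i : Fin r) → S (inject₁ i) ⊂ S (Data.Fin.suc i)

Independent : {n r : ℕ} → (Fin (suc r) → Subset n) → Subset n → Set
Independent S I = ∀ i → ∣ I ∩ S i ∣ ≤ toℕ i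

independent? : {n r : ℕ} (S : Fin (suc r) → Subset n) (I : Subset n) →
               Dec (Independent S I)
independent? S I = all? (λ i → ∣ I ∩ S i ∣ ≤? toℕ i)

allSubsets : (n : ℕ) → List (Subset n)
allSubsets zero = [] ∷ []
allSubsets (suc n) = map (true ∷_) (allSubsets n) ++ map (false ∷_) (allSubsets n)

maximum : List ℕ → ℕ
maximum = foldr _⊔_ 0

rank : {n r : ℕ} → (Fin (suc r) → Subset n) → Subset n → ℕ
rank {n} S X =
  maximum (map ∣_∣ (filter (λ I → (I ⊆? X) ×-dec independent? S I) (allSubsets n)))

closure : {n r : ℕ} → (Fin (suc r) → Subset n) → Subset n → Subset n
closure S X = tabulate (λ e → does (rank S (X ∪ ⁅ e ⁆) ≟ rank S X))

IsClosed : {n r : ℕ} → (Fin (suc r) → Subset n) → Subset n → Set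
IsClosed S X = closure S X ≡ X

-- Every independent subset of X has at most i + |X ∖ S_i| elements, since it meets S_i in
-- at most i of them. If A ⊆ S ∖ S_m meets each S_i (i > m) in at most i − m elements, then A
-- together with a transversal of S_0 ⊂ ⋯ ⊂ S_m (one new element per level) is independent,
-- so A ∪ S_m has rank m + |A|; under the strict inequalities A ∪ {e} still qualifies for every
-- e outside A ∪ S_m, so the rank jumps there and A ∪ S_m is closed.
-- Conversely let F be closed and m maximal with S_m ⊆ F (the elements of S_0 are loops). If
-- i > m were the least level with |(F ∖ S_m) ∩ S_i| ≥ i − m, then F would contain at least
-- i − p elements of S_i ∖ S_p for every p < i. Any independent J ⊆ F ∪ {e} with e ∈ S_i could
-- then trade e for such an element of F, so S_i ⊆ cl(F) = F, against the maximality of m.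

module Submission where

open import Defs
open import Data.Bool using (true; false)
open import Data.Empty using (⊥-elim)
open import Data.Fin as Fin using (Fin; toℕ; inject₁)
open import Data.Fin.Induction using (<-wellFounded; >-wellFounded; <-weakInduction; <-weakInduction-startingFrom)
open import Data.Fin.Properties using (any?; toℕ-inject₁)
open import Data.Fin.Subset using (Subset; _∈_; _∉_; _⊆_; _⊂_; _∩_; _∪_; ∁; ⊥; ⁅_⁆; _-_; ∣_∣; Empty)
open import Data.Fin.Subset.Properties
  using ( drop-there; _∈?_; _⊆?_; ⊆-refl; ⊆-trans; ⊆-antisym; ⊆-min; p⊆q⇒∣p∣≤∣q∣; p⊂q⇒∣p∣<∣q∣
        ; Empty-unique; ∣⊥∣≡0; x∈⁅y⁆⇒x≡y; ∣⁅x⁆∣≡1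
        ; x∈p∩q⁺; x∈p∩q⁻; p∩q⊆p; p∩q⊆q; ∣p∩q∣≤∣p∣; ∣p∩q∣≤∣q∣; ∩-assoc; ∩-comm; ∩-zeroˡ
        ; x∈p∪q⁺; x∈p∪q⁻; p⊆p∪q; ∩-distribʳ-∪
        ; x∈∁p⇒x∉p; x∉p⇒x∈∁p; x∈p∧x∉q⇒x∈p─q; x∈p⇒∣p-x∣<∣p∣ )
open import Data.List as List using (map; filter)
import Data.List.Membership.Propositional as Mem
import Data.List.Membership.Propositional.Properties as Mem
open import Data.List.Relation.Unary.Any using (here; there)
open import Data.Nat using (ℕ; suc; _+_; _∸_; _≤_; _<_; z≤n; s≤s; _≟_; _≤?_; _<?_)
open import Data.Nat.Properties
open import Algebra.Properties.CommutativeSemigroup +-commutativeSemigroup using (xy∙z≈xz∙y; interchange)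
open import Data.Product using (Σ; ∃; _×_; _,_; proj₁)
open import Data.Sum using (inj₁; inj₂; [_,_]′)
open import Data.Vec as Vec using ([]; _∷_; lookup)
open import Data.Vec.Properties using (tabulate∘lookup; tabulate-cong; lookup∘tabulate; lookup⇒[]=; []=⇒lookup)
open import Function using (id; _∘_)
open import Function.Bundles using (_⇔_; mk⇔)
open import Induction.WellFounded using (Acc; acc)
open import Relation.Nullary using (¬_; Dec; yes; no; does)
open import Relation.Nullary.Decidable using (dec-true; dec-false; _×-dec_)
open import Relation.Binary.PropositionalEquality

∣p∪q∣≤∣p∣+∣q∣ : ∀ {n} (p q : Subset n) → ∣ p ∪ q ∣ ≤ ∣ p ∣ + ∣ q ∣
∣p∪q∣≤∣p∣+∣q∣ []           []           = z≤n
∣p∪q∣≤∣p∣+∣q∣ (true ∷ p)  (true ∷ q)  =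
  s≤s (≤-trans (∣p∪q∣≤∣p∣+∣q∣ p q) (≤-trans (n≤1+n _) (≤-reflexive (sym (+-suc _ _)))))
∣p∪q∣≤∣p∣+∣q∣ (true ∷ p)  (false ∷ q) = s≤s (∣p∪q∣≤∣p∣+∣q∣ p q)
∣p∪q∣≤∣p∣+∣q∣ (false ∷ p) (true ∷ q)  = ≤-trans (s≤s (∣p∪q∣≤∣p∣+∣q∣ p q)) (≤-reflexive (sym (+-suc _ _)))
∣p∪q∣≤∣p∣+∣q∣ (false ∷ p) (false ∷ q) = ∣p∪q∣≤∣p∣+∣q∣ p q

∣p∪q∣≡∣p∣+∣q∣ : ∀ {n} (p q : Subset n) → (∀ {x} → x ∈ p → x ∉ q) → ∣ p ∪ q ∣ ≡ ∣ p ∣ + ∣ q ∣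
∣p∪q∣≡∣p∣+∣q∣ []           []           _        = refl
∣p∪q∣≡∣p∣+∣q∣ (true ∷ p)  (true ∷ q)  disjoint = ⊥-elim (disjoint Vec.here Vec.here)
∣p∪q∣≡∣p∣+∣q∣ (true ∷ p)  (false ∷ q) disjoint =
  cong suc (∣p∪q∣≡∣p∣+∣q∣ p q (λ x∈p x∈q → disjoint (Vec.there x∈p) (Vec.there x∈q)))
∣p∪q∣≡∣p∣+∣q∣ (false ∷ p) (true ∷ q)  disjoint =
  trans (cong suc (∣p∪q∣≡∣p∣+∣q∣ p q (λ x∈p x∈q → disjoint (Vec.there x∈p) (Vec.there x∈q)))) (sym (+-suc _ _))
∣p∪q∣≡∣p∣+∣q∣ (false ∷ p) (false ∷ q) disjoint =
  ∣p∪q∣≡∣p∣+∣q∣ p q (λ x∈p x∈q → disjoint (Vec.there x∈p) (Vec.there x∈q))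

∣p∣≡∣p∩q∣+∣p∩∁q∣ : ∀ {n} (p q : Subset n) → ∣ p ∣ ≡ ∣ p ∩ q ∣ + ∣ p ∩ ∁ q ∣
∣p∣≡∣p∩q∣+∣p∩∁q∣ []           []           = refl
∣p∣≡∣p∩q∣+∣p∩∁q∣ (true ∷ p)  (true ∷ q)  = cong suc (∣p∣≡∣p∩q∣+∣p∩∁q∣ p q)
∣p∣≡∣p∩q∣+∣p∩∁q∣ (true ∷ p)  (false ∷ q) = trans (cong suc (∣p∣≡∣p∩q∣+∣p∩∁q∣ p q)) (sym (+-suc _ _))
∣p∣≡∣p∩q∣+∣p∩∁q∣ (false ∷ p) (true ∷ q)  = ∣p∣≡∣p∩q∣+∣p∩∁q∣ p q
∣p∣≡∣p∩q∣+∣p∩∁q∣ (false ∷ p) (false ∷ q) = ∣p∣≡∣p∩q∣+∣p∩∁q∣ p q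

private
  there⁺ : ∀ {n s t} {p q : Subset n} → ∃ (λ x → x ∈ q × x ∉ p) → ∃ λ x → x ∈ t ∷ q × x ∉ s ∷ p
  there⁺ (x , x∈q , x∉p) = Fin.suc x , Vec.there x∈q , x∉p ∘ drop-there

∣p∣<∣q∣⇒q⊈p : ∀ {n} (p q : Subset n) → ∣ p ∣ < ∣ q ∣ → ∃ λ x → x ∈ q × x ∉ p
∣p∣<∣q∣⇒q⊈p (false ∷ p) (true ∷ q)  _        = Fin.zero , Vec.here , λ ()
∣p∣<∣q∣⇒q⊈p (true ∷ p)  (true ∷ q)  (s≤s lt) = there⁺ (∣p∣<∣q∣⇒q⊈p p q lt)
∣p∣<∣q∣⇒q⊈p (true ∷ p)  (false ∷ q) lt       = there⁺ (∣p∣<∣q∣⇒q⊈p p q (<-trans (n<1+n _) lt))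
∣p∣<∣q∣⇒q⊈p (false ∷ p) (false ∷ q) lt       = there⁺ (∣p∣<∣q∣⇒q⊈p p q lt)

x∈p⇒0<∣p∣ : ∀ {n} {x : Fin n} {p : Subset n} → x ∈ p → 0 < ∣ p ∣
x∈p⇒0<∣p∣ {x = x} x∈p =
  subst (_≤ _) (∣⁅x⁆∣≡1 x) (p⊆q⇒∣p∣≤∣q∣ λ y∈⁅x⁆ → subst (_∈ _) (sym (x∈⁅y⁆⇒x≡y x y∈⁅x⁆)) x∈p)

Empty⇒∣p∣≡0 : ∀ {n} {p : Subset n} → Empty p → ∣ p ∣ ≡ 0
Empty⇒∣p∣≡0 {n} empty = trans (cong ∣_∣ (Empty-unique empty)) (∣⊥∣≡0 n)

∣[p∪q]∩r∣≤∣p∩r∣+∣q∩r∣ : ∀ {n} (p q r : Subset n) → ∣ (p ∪ q) ∩ r ∣ ≤ ∣ p ∩ r ∣ + ∣ q ∩ r ∣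
∣[p∪q]∩r∣≤∣p∩r∣+∣q∩r∣ p q r =
  subst (_≤ ∣ p ∩ r ∣ + ∣ q ∩ r ∣) (cong ∣_∣ (sym (∩-distribʳ-∪ r p q))) (∣p∪q∣≤∣p∣+∣q∣ (p ∩ r) (q ∩ r))

q⊆p⇒p∩q≡q : ∀ {n} {p q : Subset n} → q ⊆ p → p ∩ q ≡ q
q⊆p⇒p∩q≡q {p = p} {q} q⊆p = ⊆-antisym (p∩q⊆q p q) (λ x∈q → x∈p∩q⁺ (q⊆p x∈q , x∈q))

∣p∩r∣≡∣p∩q∣+∣p∩[r∩∁q]∣ : ∀ {n} (p : Subset n) {q r : Subset n} → q ⊆ r →
                         ∣ p ∩ r ∣ ≡ ∣ p ∩ q ∣ + ∣ p ∩ (r ∩ ∁ q) ∣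
∣p∩r∣≡∣p∩q∣+∣p∩[r∩∁q]∣ p {q} {r} q⊆r =
  trans (∣p∣≡∣p∩q∣+∣p∩∁q∣ (p ∩ r) q)
        (cong₂ _+_ (cong ∣_∣ (trans (∩-assoc p r q) (cong (p ∩_) (q⊆p⇒p∩q≡q q⊆r)))) (cong ∣_∣ (∩-assoc p r (∁ q))))

p∪⁅x⁆≡p : ∀ {n} {x : Fin n} {p : Subset n} → x ∈ p → p ∪ ⁅ x ⁆ ≡ p
p∪⁅x⁆≡p {x = x} {p} x∈p = ⊆-antisym
  (λ y∈ → [ id , (λ y∈⁅x⁆ → subst (_∈ p) (sym (x∈⁅y⁆⇒x≡y x y∈⁅x⁆)) x∈p) ]′ (x∈p∪q⁻ p ⁅ x ⁆ y∈))
  (p⊆p∪q ⁅ x ⁆)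

∣[p∪⁅x⁆]∩q∣≤1+∣p∩q∣ : ∀ {n} (p : Subset n) x q → ∣ (p ∪ ⁅ x ⁆) ∩ q ∣ ≤ suc ∣ p ∩ q ∣
∣[p∪⁅x⁆]∩q∣≤1+∣p∩q∣ p x q = begin
  ∣ (p ∪ ⁅ x ⁆) ∩ q ∣          ≤⟨ ∣[p∪q]∩r∣≤∣p∩r∣+∣q∩r∣ p ⁅ x ⁆ q ⟩
  ∣ p ∩ q ∣ + ∣ ⁅ x ⁆ ∩ q ∣    ≤⟨ +-monoʳ-≤ ∣ p ∩ q ∣ (≤-trans (∣p∩q∣≤∣p∣ ⁅ x ⁆ q) (≤-reflexive (∣⁅x⁆∣≡1 x))) ⟩
  ∣ p ∩ q ∣ + 1                ≡⟨ +-comm ∣ p ∩ q ∣ 1 ⟩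
  suc ∣ p ∩ q ∣                ∎
  where open ≤-Reasoning

x∉p⇒∣p∪⁅x⁆∣≡1+∣p∣ : ∀ {n} {x : Fin n} {p : Subset n} → x ∉ p → ∣ p ∪ ⁅ x ⁆ ∣ ≡ suc ∣ p ∣
x∉p⇒∣p∪⁅x⁆∣≡1+∣p∣ {x = x} {p} x∉p = begin
  ∣ p ∪ ⁅ x ⁆ ∣        ≡⟨ ∣p∪q∣≡∣p∣+∣q∣ p ⁅ x ⁆ (λ y∈p y∈⁅x⁆ → x∉p (subst (_∈ p) (x∈⁅y⁆⇒x≡y x y∈⁅x⁆) y∈p)) ⟩
  ∣ p ∣ + ∣ ⁅ x ⁆ ∣    ≡⟨ cong (∣ p ∣ +_) (∣⁅x⁆∣≡1 x) ⟩
  ∣ p ∣ + 1            ≡⟨ +-comm ∣ p ∣ 1 ⟩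
  suc ∣ p ∣            ∎
  where open ≡-Reasoning

∣[p∩∁⁅x⁆]∩q∣<∣p∩q∣ : ∀ {n} {x : Fin n} {p q : Subset n} → x ∈ p → x ∈ q → ∣ (p ∩ ∁ ⁅ x ⁆) ∩ q ∣ < ∣ p ∩ q ∣
∣[p∩∁⁅x⁆]∩q∣<∣p∩q∣ {x = x} {p} {q} x∈p x∈q =
  ≤-trans (s≤s (p⊆q⇒∣p∣≤∣q∣ ⊆[p∩q]-x)) (x∈p⇒∣p-x∣<∣p∣ (x∈p∩q⁺ (x∈p , x∈q)))
  where
  ⊆[p∩q]-x : (p ∩ ∁ ⁅ x ⁆) ∩ q ⊆ (p ∩ q) - x
  ⊆[p∩q]-x y∈ = let (y∈p∖x , y∈q) = x∈p∩q⁻ (p ∩ ∁ ⁅ x ⁆) q y∈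
                    (y∈p , y∉⁅x⁆) = x∈p∩q⁻ p (∁ ⁅ x ⁆) y∈p∖x
                in x∈p∧x∉q⇒x∈p─q (x∈p∩q⁺ (y∈p , y∈q)) (x∈∁p⇒x∉p y∉⁅x⁆)

∣p∣≤1+∣p∩∁⁅x⁆∣ : ∀ {n} (p : Subset n) x → ∣ p ∣ ≤ suc ∣ p ∩ ∁ ⁅ x ⁆ ∣
∣p∣≤1+∣p∩∁⁅x⁆∣ p x = ≤-trans (≤-reflexive (∣p∣≡∣p∩q∣+∣p∩∁q∣ p ⁅ x ⁆))
                            (+-monoˡ-≤ ∣ p ∩ ∁ ⁅ x ⁆ ∣ (≤-trans (∣p∩q∣≤∣q∣ p ⁅ x ⁆) (≤-reflexive (∣⁅x⁆∣≡1 x))))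

q⊆p⇒[p∩∁q]∪q≡p : ∀ {n} {p q : Subset n} → q ⊆ p → (p ∩ ∁ q) ∪ q ≡ p
q⊆p⇒[p∩∁q]∪q≡p {p = p} {q} q⊆p = ⊆-antisym
  (λ x∈ → [ proj₁ ∘ x∈p∩q⁻ p (∁ q) , q⊆p ]′ (x∈p∪q⁻ (p ∩ ∁ q) q x∈))
  (λ {x} x∈p → split x∈p (x ∈? q))
  where
  split : ∀ {x} → x ∈ p → Dec (x ∈ q) → x ∈ (p ∩ ∁ q) ∪ q
  split x∈p (yes x∈q) = x∈p∪q⁺ (inj₂ x∈q)
  split x∈p (no x∉q)  = x∈p∪q⁺ (inj₁ (x∈p∩q⁺ (x∈p , x∉p⇒x∈∁p x∉q)))

greatest : ∀ {n} {P : Fin n → Set} → (∀ j → Dec (P j)) → ∀ {z} → P z →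
           ∃ λ p → P p × (∀ j → toℕ p < toℕ j → ¬ P j)
greatest {P = P} P? = search (>-wellFounded _)
  where
  search : ∀ {z} → Acc Fin._>_ z → P z → ∃ λ p → P p × (∀ j → toℕ p < toℕ j → ¬ P j)
  search {z} (acc above) Pz with any? (λ j → (toℕ z <? toℕ j) ×-dec P? j)
  ... | yes (j , z<j , Pj) = search (above z<j) Pj
  ... | no none            = z , Pz , λ j z<j Pj → none (j , z<j , Pj)

allSubsets-complete : ∀ {n} (p : Subset n) → p Mem.∈ allSubsets n
allSubsets-complete []                = here refl
allSubsets-complete {suc n} (true ∷ p)  =
  Mem.∈-++⁺ˡ (Mem.∈-map⁺ (true ∷_) (allSubsets-complete p))
allSubsets-complete {suc n} (false ∷ p) =
  Mem.∈-++⁺ʳ (map (true ∷_) (allSubsets n)) (Mem.∈-map⁺ (false ∷_) (allSubsets-complete p))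

∈⇒≤maximum : ∀ {x xs} → x Mem.∈ xs → x ≤ maximum xs
∈⇒≤maximum {xs = y List.∷ ys} (here refl) = m≤m⊔n y (maximum ys)
∈⇒≤maximum {xs = y List.∷ ys} (there x∈ys) = ≤-trans (∈⇒≤maximum x∈ys) (m≤n⊔m y (maximum ys))

maximum≤ : ∀ xs {k} → (∀ {x} → x Mem.∈ xs → x ≤ k) → maximum xs ≤ k
maximum≤ List.[]       bound = z≤n
maximum≤ (x List.∷ xs) bound = ⊔-lub (bound (here refl)) (maximum≤ xs (bound ∘ there))

module _ {n r : ℕ} (S : Fin (suc r) → Subset n) where

  private
    admissible? : (X I : Subset n) → Dec (I ⊆ X × Independent S I)
    admissible? X I = (I ⊆? X) ×-dec independent? S I

  independent⇒∣I∣≤rank : ∀ {I X} → I ⊆ X → Independent S I → ∣ I ∣ ≤ rank S X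
  independent⇒∣I∣≤rank {I} {X} I⊆X indep =
    ∈⇒≤maximum (Mem.∈-map⁺ ∣_∣ (Mem.∈-filter⁺ (admissible? X) (allSubsets-complete I) (I⊆X , indep)))

  rank≤ : ∀ {X} k → (∀ I → I ⊆ X → Independent S I → ∣ I ∣ ≤ k) → rank S X ≤ k
  rank≤ {X} k bound = maximum≤ (map ∣_∣ (filter (admissible? X) (allSubsets n))) λ x∈ →
    let (I , I∈ , x≡∣I∣) = Mem.∈-map⁻ ∣_∣ x∈
        (_ , I⊆X , indep) = Mem.∈-filter⁻ (admissible? X) {xs = allSubsets n} I∈
    in subst (_≤ k) (sym x≡∣I∣) (bound I I⊆X indep)

  independent-⊆ : ∀ {I J} → I ⊆ J → Independent S J → Independent S I
  independent-⊆ {I} {J} I⊆J indep j =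
    ≤-trans (p⊆q⇒∣p∣≤∣q∣ (λ x∈ → let (x∈I , x∈Sj) = x∈p∩q⁻ I (S j) x∈ in x∈p∩q⁺ (I⊆J x∈I , x∈Sj))) (indep j)

  rank-mono : ∀ {X Y} → X ⊆ Y → rank S X ≤ rank S Y
  rank-mono X⊆Y = rank≤ _ λ I I⊆X indep → independent⇒∣I∣≤rank (⊆-trans I⊆X X⊆Y) indep

  rank≤index+∣outside∣ : ∀ X i → rank S X ≤ toℕ i + ∣ X ∩ ∁ (S i) ∣
  rank≤index+∣outside∣ X i = rank≤ _ λ I I⊆X indep → begin
    ∣ I ∣                          ≡⟨ ∣p∣≡∣p∩q∣+∣p∩∁q∣ I (S i) ⟩
    ∣ I ∩ S i ∣ + ∣ I ∩ ∁ (S i) ∣  ≤⟨ +-mono-≤ (indep i) (p⊆q⇒∣p∣≤∣q∣ (outside I⊆X)) ⟩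
    toℕ i + ∣ X ∩ ∁ (S i) ∣        ∎
    where
    open ≤-Reasoning
    outside : ∀ {I} → I ⊆ X → I ∩ ∁ (S i) ⊆ X ∩ ∁ (S i)
    outside {I} I⊆X x∈ = let (x∈I , x∉Si) = x∈p∩q⁻ I _ x∈ in x∈p∩q⁺ (I⊆X x∈I , x∉Si)

  Dominated : Subset n → Subset n → Set
  Dominated Y X = ∀ J → J ⊆ Y → Independent S J → ∃ λ J′ → J′ ⊆ X × Independent S J′ × ∣ J ∣ ≤ ∣ J′ ∣

  dominated⇒rank≤ : ∀ {X Y} → Dominated Y X → rank S Y ≤ rank S X
  dominated⇒rank≤ dominated = rank≤ _ λ J J⊆Y indep →
    let (J′ , J′⊆X , indep′ , ∣J∣≤∣J′∣) = dominated J J⊆Y indep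
    in ≤-trans ∣J∣≤∣J′∣ (independent⇒∣I∣≤rank J′⊆X indep′)

  closed⇒∈ : ∀ {F e} → IsClosed S F → rank S (F ∪ ⁅ e ⁆) ≤ rank S F → e ∈ F
  closed⇒∈ {F} {e} closed no-gain = lookup⇒[]= e F (begin
    lookup F e                            ≡⟨ cong (λ X → lookup X e) closed ⟨
    lookup (closure S F) e                ≡⟨ lookup∘tabulate _ e ⟩
    does (rank S (F ∪ ⁅ e ⁆) ≟ rank S F)  ≡⟨ dec-true (rank S (F ∪ ⁅ e ⁆) ≟ rank S F)
                                                       (≤-antisym no-gain (rank-mono (p⊆p∪q _))) ⟩
    true                                  ∎)
    where open ≡-Reasoning

  rank-jumps⇒closed : ∀ {F} → (∀ e → e ∉ F → rank S F < rank S (F ∪ ⁅ e ⁆)) → IsClosed S F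
  rank-jumps⇒closed {F} jumps = trans (tabulate-cong pointwise) (tabulate∘lookup F)
    where
    pointwise : ∀ e → does (rank S (F ∪ ⁅ e ⁆) ≟ rank S F) ≡ lookup F e
    pointwise e with lookup F e in e∈?F
    ... | true  = dec-true (rank S (F ∪ ⁅ e ⁆) ≟ rank S F) (cong (rank S) (p∪⁅x⁆≡p (lookup⇒[]= e F e∈?F)))
    ... | false = dec-false (rank S (F ∪ ⁅ e ⁆) ≟ rank S F) (λ same → <-irrefl (sym same) (jumps e e∉F))
      where
      e∉F : e ∉ F
      e∉F e∈F with trans (sym ([]=⇒lookup e∈F)) e∈?F
      ... | ()

  ∪⁅x⁆-independent : ∀ {K x} → Independent S K → (∀ j → x ∈ S j → ∣ K ∩ S j ∣ < toℕ j) →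
                     Independent S (K ∪ ⁅ x ⁆)
  ∪⁅x⁆-independent {K} {x} indep room j with x ∈? S j
  ... | yes x∈Sj = ≤-trans (∣[p∪⁅x⁆]∩q∣≤1+∣p∩q∣ K x (S j)) (room j x∈Sj)
  ... | no x∉Sj  = begin
    ∣ (K ∪ ⁅ x ⁆) ∩ S j ∣          ≤⟨ ∣[p∪q]∩r∣≤∣p∩r∣+∣q∩r∣ K ⁅ x ⁆ (S j) ⟩
    ∣ K ∩ S j ∣ + ∣ ⁅ x ⁆ ∩ S j ∣  ≡⟨ cong (∣ K ∩ S j ∣ +_) (Empty⇒∣p∣≡0 ⁅x⁆∩Sj-empty) ⟩
    ∣ K ∩ S j ∣ + 0                ≡⟨ +-identityʳ _ ⟩
    ∣ K ∩ S j ∣                    ≤⟨ indep j ⟩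
    toℕ j                          ∎
    where
    open ≤-Reasoning
    ⁅x⁆∩Sj-empty : Empty (⁅ x ⁆ ∩ S j)
    ⁅x⁆∩Sj-empty (y , y∈) =
      let (y∈⁅x⁆ , y∈Sj) = x∈p∩q⁻ ⁅ x ⁆ (S j) y∈ in x∉Sj (subst (_∈ S j) (x∈⁅y⁆⇒x≡y x y∈⁅x⁆) y∈Sj)

module FreedomMatroid {n r : ℕ} {S : Fin (suc r) → Subset n} (flag : IsFlag S) where
  S-step : ∀ j → S (inject₁ j) ⊂ S (Fin.suc j)
  S-step = IsFlag.strict flag

  S-mono : ∀ {i j} → toℕ i ≤ toℕ j → S i ⊆ S j
  S-mono {i} = <-weakInduction-startingFrom (λ j → S i ⊆ S j) ⊆-refl
                 (λ j Si⊆Sj → ⊆-trans Si⊆Sj (proj₁ (S-step j)))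

  ∣S∣-gap : ∀ {i j} → toℕ i ≤ toℕ j → ∣ S i ∣ + toℕ j ≤ ∣ S j ∣ + toℕ i
  ∣S∣-gap {i} = <-weakInduction-startingFrom (λ j → ∣ S i ∣ + toℕ j ≤ ∣ S j ∣ + toℕ i) ≤-refl step
    where
    open ≤-Reasoning
    step : ∀ j → ∣ S i ∣ + toℕ (inject₁ j) ≤ ∣ S (inject₁ j) ∣ + toℕ i →
           ∣ S i ∣ + suc (toℕ j) ≤ ∣ S (Fin.suc j) ∣ + toℕ i
    step j gap = begin
      ∣ S i ∣ + suc (toℕ j)            ≡⟨ +-suc ∣ S i ∣ (toℕ j) ⟩
      suc (∣ S i ∣ + toℕ j)            ≡⟨ cong (λ k → suc (∣ S i ∣ + k)) (toℕ-inject₁ j) ⟨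
      suc (∣ S i ∣ + toℕ (inject₁ j))  ≤⟨ s≤s gap ⟩
      suc (∣ S (inject₁ j) ∣ + toℕ i)  ≤⟨ +-monoˡ-≤ (toℕ i) (p⊂q⇒∣p∣<∣q∣ (S-step j)) ⟩
      ∣ S (Fin.suc j) ∣ + toℕ i        ∎

  Transversal : Fin (suc r) → Set
  Transversal j = ∃ λ T → T ⊆ S j × ∣ T ∣ ≡ toℕ j × Independent S T

  transversal : ∀ j → Transversal j
  transversal = <-weakInduction Transversal (⊥ , ⊆-min (S Fin.zero) , ∣⊥∣≡0 n , ⊥-independent) extend
    where
    ⊥-independent : Independent S ⊥
    ⊥-independent l = subst (_≤ toℕ l) (sym (trans (cong ∣_∣ (∩-zeroˡ (S l))) (∣⊥∣≡0 n))) z≤n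
    extend : ∀ j → Transversal (inject₁ j) → Transversal (Fin.suc j)
    extend j (T , T⊆Sj , ∣T∣≡j , indep) with S-step j
    ... | Sj⊆Sj+1 , x , x∈Sj+1 , x∉Sj =
      T ∪ ⁅ x ⁆ , T∪x⊆Sj+1 , trans (x∉p⇒∣p∪⁅x⁆∣≡1+∣p∣ (x∉Sj ∘ T⊆Sj)) (cong suc (trans ∣T∣≡j (toℕ-inject₁ j))) ,
      ∪⁅x⁆-independent S {T} {x} indep room
      where
      T∪x⊆Sj+1 : T ∪ ⁅ x ⁆ ⊆ S (Fin.suc j)
      T∪x⊆Sj+1 y∈ = [ Sj⊆Sj+1 ∘ T⊆Sj , (λ y∈⁅x⁆ → subst (_∈ _) (sym (x∈⁅y⁆⇒x≡y x y∈⁅x⁆)) x∈Sj+1) ]′ (x∈p∪q⁻ T ⁅ x ⁆ y∈)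
      room : ∀ l → x ∈ S l → ∣ T ∩ S l ∣ < toℕ l
      room l x∈Sl with toℕ l ≤? toℕ (inject₁ j)
      ... | yes l≤j = ⊥-elim (x∉Sj (S-mono l≤j x∈Sl))
      ... | no l≰j  = ≤-trans (s≤s (≤-trans (∣p∩q∣≤∣p∣ T (S l)) (≤-reflexive ∣T∣≡j))) (≰⇒> l≰j)

  rank-lower-bound : ∀ {m B X} → B ⊆ ∁ (S m) →
                     (∀ j → toℕ m < toℕ j → ∣ B ∩ S j ∣ ≤ toℕ j ∸ toℕ m) →
                     B ∪ S m ⊆ X → toℕ m + ∣ B ∣ ≤ rank S X
  rank-lower-bound {m} {B} {X} B⊆∁Sm sparse B∪Sm⊆X with transversal m
  ... | T , T⊆Sm , ∣T∣≡m , indepT = begin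
    toℕ m + ∣ B ∣  ≡⟨ +-comm (toℕ m) ∣ B ∣ ⟩
    ∣ B ∣ + toℕ m  ≡⟨ cong (∣ B ∣ +_) ∣T∣≡m ⟨
    ∣ B ∣ + ∣ T ∣  ≡⟨ ∣p∪q∣≡∣p∣+∣q∣ B T (λ x∈B x∈T → x∈∁p⇒x∉p (B⊆∁Sm x∈B) (T⊆Sm x∈T)) ⟨
    ∣ B ∪ T ∣      ≤⟨ independent⇒∣I∣≤rank S (B∪Sm⊆X ∘ B∪T⊆B∪Sm) indep ⟩
    rank S X       ∎
    where
    open ≤-Reasoning
    B∪T⊆B∪Sm : B ∪ T ⊆ B ∪ S m
    B∪T⊆B∪Sm x∈ = [ x∈p∪q⁺ ∘ inj₁ , x∈p∪q⁺ ∘ inj₂ ∘ T⊆Sm ]′ (x∈p∪q⁻ B T x∈)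
    indep : Independent S (B ∪ T)
    indep j with toℕ j ≤? toℕ m
    ... | yes j≤m = begin
      ∣ (B ∪ T) ∩ S j ∣          ≤⟨ ∣[p∪q]∩r∣≤∣p∩r∣+∣q∩r∣ B T (S j) ⟩
      ∣ B ∩ S j ∣ + ∣ T ∩ S j ∣  ≡⟨ cong (_+ ∣ T ∩ S j ∣) (Empty⇒∣p∣≡0 B∩Sj-empty) ⟩
      ∣ T ∩ S j ∣                ≤⟨ indepT j ⟩
      toℕ j                      ∎
      where
      B∩Sj-empty : Empty (B ∩ S j)
      B∩Sj-empty (x , x∈) = let (x∈B , x∈Sj) = x∈p∩q⁻ B (S j) x∈ in x∈∁p⇒x∉p (B⊆∁Sm x∈B) (S-mono j≤m x∈Sj)
    ... | no j≰m = begin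
      ∣ (B ∪ T) ∩ S j ∣          ≤⟨ ∣[p∪q]∩r∣≤∣p∩r∣+∣q∩r∣ B T (S j) ⟩
      ∣ B ∩ S j ∣ + ∣ T ∩ S j ∣  ≤⟨ +-mono-≤ (sparse j (≰⇒> j≰m)) (≤-trans (∣p∩q∣≤∣p∣ T (S j)) (≤-reflexive ∣T∣≡m)) ⟩
      toℕ j ∸ toℕ m + toℕ m      ≡⟨ m∸n+n≡m (<⇒≤ (≰⇒> j≰m)) ⟩
      toℕ j                      ∎

  rank[A∪S]≡ : ∀ {m A} → A ⊆ ∁ (S m) →
               (∀ j → toℕ m < toℕ j → ∣ A ∩ S j ∣ ≤ toℕ j ∸ toℕ m) →
               rank S (A ∪ S m) ≡ toℕ m + ∣ A ∣
  rank[A∪S]≡ {m} {A} A⊆∁Sm sparse = ≤-antisym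
    (≤-trans (rank≤index+∣outside∣ S (A ∪ S m) m) (+-monoʳ-≤ (toℕ m) (p⊆q⇒∣p∣≤∣q∣ outside⊆A)))
    (rank-lower-bound A⊆∁Sm sparse ⊆-refl)
    where
    outside⊆A : (A ∪ S m) ∩ ∁ (S m) ⊆ A
    outside⊆A x∈ = let (x∈A∪Sm , x∉Sm) = x∈p∩q⁻ (A ∪ S m) (∁ (S m)) x∈
                   in [ id , ⊥-elim ∘ x∈∁p⇒x∉p x∉Sm ]′ (x∈p∪q⁻ A (S m) x∈A∪Sm)

  A∪S-closed : ∀ {m A} → A ⊆ ∁ (S m) →
               (∀ j → toℕ m < toℕ j → ∣ A ∩ S j ∣ < toℕ j ∸ toℕ m) →
               IsClosed S (A ∪ S m)
  A∪S-closed {m} {A} A⊆∁Sm sparse = rank-jumps⇒closed S jumps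
    where
    jumps : ∀ e → e ∉ A ∪ S m → rank S (A ∪ S m) < rank S ((A ∪ S m) ∪ ⁅ e ⁆)
    jumps e e∉A∪Sm = begin-strict
      rank S (A ∪ S m)            ≡⟨ rank[A∪S]≡ A⊆∁Sm (λ j m<j → <⇒≤ (sparse j m<j)) ⟩
      toℕ m + ∣ A ∣                <⟨ +-monoʳ-< (toℕ m) (n<1+n ∣ A ∣) ⟩
      toℕ m + suc ∣ A ∣            ≡⟨ cong (toℕ m +_) (x∉p⇒∣p∪⁅x⁆∣≡1+∣p∣ (e∉A∪Sm ∘ x∈p∪q⁺ ∘ inj₁)) ⟨
      toℕ m + ∣ A ∪ ⁅ e ⁆ ∣        ≤⟨ rank-lower-bound A∪e⊆∁Sm A∪e-sparse A∪e∪Sm⊆ ⟩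
      rank S ((A ∪ S m) ∪ ⁅ e ⁆)  ∎
      where
      open ≤-Reasoning
      A∪e⊆∁Sm : A ∪ ⁅ e ⁆ ⊆ ∁ (S m)
      A∪e⊆∁Sm x∈ = [ A⊆∁Sm , (λ x∈⁅e⁆ → x∉p⇒x∈∁p λ x∈Sm →
                       e∉A∪Sm (x∈p∪q⁺ (inj₂ (subst (_∈ S m) (x∈⁅y⁆⇒x≡y e x∈⁅e⁆) x∈Sm)))) ]′
                     (x∈p∪q⁻ A ⁅ e ⁆ x∈)
      A∪e-sparse : ∀ j → toℕ m < toℕ j → ∣ (A ∪ ⁅ e ⁆) ∩ S j ∣ ≤ toℕ j ∸ toℕ m
      A∪e-sparse j m<j = ≤-trans (∣[p∪⁅x⁆]∩q∣≤1+∣p∩q∣ A e (S j)) (sparse j m<j)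
      A∪e∪Sm⊆ : (A ∪ ⁅ e ⁆) ∪ S m ⊆ (A ∪ S m) ∪ ⁅ e ⁆
      A∪e∪Sm⊆ x∈ = [ [ x∈p∪q⁺ ∘ inj₁ ∘ x∈p∪q⁺ ∘ inj₁ , x∈p∪q⁺ ∘ inj₂ ]′ ∘ x∈p∪q⁻ A ⁅ e ⁆
                     , x∈p∪q⁺ ∘ inj₁ ∘ x∈p∪q⁺ ∘ inj₂ ]′
                     (x∈p∪q⁻ (A ∪ ⁅ e ⁆) (S m) x∈)

  Saturates : Subset n → Fin (suc r) → Set
  Saturates F i = ∀ p → toℕ p < toℕ i → ∣ F ∩ S p ∣ + toℕ i ≤ ∣ F ∩ S i ∣ + toℕ p

  spare-element : ∀ {F K i p} → Saturates F i → ∣ K ∩ S i ∣ < toℕ i → toℕ p < toℕ i → toℕ p ≤ ∣ K ∩ S p ∣ →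
                  ∃ λ a → a ∈ F × a ∈ S i × a ∉ S p × a ∉ K
  spare-element {F} {K} {i} {p} saturated K-room p<i K-tight =
    spare (∣p∣<∣q∣⇒q⊈p (K ∩ D) (F ∩ D) (+-cancelʳ-≤ (toℕ p) _ _ count))
    where
    open ≤-Reasoning
    D : Subset n
    D = S i ∩ ∁ (S p)
    split : ∀ X → ∣ X ∩ S i ∣ ≡ ∣ X ∩ S p ∣ + ∣ X ∩ D ∣
    split X = ∣p∩r∣≡∣p∩q∣+∣p∩[r∩∁q]∣ X (S-mono (<⇒≤ p<i))
    ∣K∩D∣+∣K∩Sp∣≡∣K∩Si∣ : ∣ K ∩ D ∣ + ∣ K ∩ S p ∣ ≡ ∣ K ∩ S i ∣
    ∣K∩D∣+∣K∩Sp∣≡∣K∩Si∣ = trans (+-comm ∣ K ∩ D ∣ ∣ K ∩ S p ∣) (sym (split K))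
    count : suc ∣ K ∩ D ∣ + toℕ p ≤ ∣ F ∩ D ∣ + toℕ p
    count = +-cancelˡ-≤ ∣ F ∩ S p ∣ _ _ (begin
      ∣ F ∩ S p ∣ + (suc ∣ K ∩ D ∣ + toℕ p)        ≤⟨ +-monoʳ-≤ ∣ F ∩ S p ∣ (+-monoʳ-≤ (suc ∣ K ∩ D ∣) K-tight) ⟩
      ∣ F ∩ S p ∣ + (suc ∣ K ∩ D ∣ + ∣ K ∩ S p ∣)  ≡⟨ cong (λ k → ∣ F ∩ S p ∣ + suc k) ∣K∩D∣+∣K∩Sp∣≡∣K∩Si∣ ⟩
      ∣ F ∩ S p ∣ + suc ∣ K ∩ S i ∣                ≤⟨ +-monoʳ-≤ ∣ F ∩ S p ∣ K-room ⟩
      ∣ F ∩ S p ∣ + toℕ i                          ≤⟨ saturated p p<i ⟩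
      ∣ F ∩ S i ∣ + toℕ p                          ≡⟨ cong (_+ toℕ p) (split F) ⟩
      (∣ F ∩ S p ∣ + ∣ F ∩ D ∣) + toℕ p            ≡⟨ +-assoc ∣ F ∩ S p ∣ ∣ F ∩ D ∣ (toℕ p) ⟩
      ∣ F ∩ S p ∣ + (∣ F ∩ D ∣ + toℕ p)            ∎)
    spare : (∃ λ a → a ∈ F ∩ D × a ∉ K ∩ D) → ∃ λ a → a ∈ F × a ∈ S i × a ∉ S p × a ∉ K
    spare (a , a∈F∩D , a∉K∩D) =
      let (a∈F , a∈D) = x∈p∩q⁻ F D a∈F∩D
          (a∈Si , a∈∁Sp) = x∈p∩q⁻ (S i) (∁ (S p)) a∈D
      in a , a∈F , a∈Si , x∈∁p⇒x∉p a∈∁Sp , λ a∈K → a∉K∩D (x∈p∩q⁺ (a∈K , a∈D))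

  -- Let p be the last level below i at which J ∖ {e} is tight; F has more elements than
  -- J ∖ {e} in S i ∖ S p, and one of them can take the place of e.
  exchange : ∀ {F i e J} → Saturates F i → e ∈ S i → e ∈ J → J ⊆ F ∪ ⁅ e ⁆ → Independent S J →
             ∃ λ J′ → J′ ⊆ F × Independent S J′ × ∣ J ∣ ≤ ∣ J′ ∣
  exchange {F} {i} {e} {J} saturated e∈Si e∈J J⊆F∪e indepJ =
    swap (greatest (λ j → (toℕ j <? toℕ i) ×-dec (toℕ j ≤? ∣ K ∩ S j ∣)) {Fin.zero} (0<i , z≤n))
    where
    K : Subset n
    K = J ∩ ∁ ⁅ e ⁆
    K⊆F : K ⊆ F
    K⊆F x∈K = let (x∈J , x∉⁅e⁆) = x∈p∩q⁻ J (∁ ⁅ e ⁆) x∈K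
              in [ id , ⊥-elim ∘ x∈∁p⇒x∉p x∉⁅e⁆ ]′ (x∈p∪q⁻ F ⁅ e ⁆ (J⊆F∪e x∈J))
    Tight : Fin (suc r) → Set
    Tight j = toℕ j < toℕ i × toℕ j ≤ ∣ K ∩ S j ∣
    0<i : 0 < toℕ i
    0<i = ≤-trans (x∈p⇒0<∣p∣ (x∈p∩q⁺ (e∈J , e∈Si))) (indepJ i)
    swap : (∃ λ p → Tight p × (∀ j → toℕ p < toℕ j → ¬ Tight j)) →
           ∃ λ J′ → J′ ⊆ F × Independent S J′ × ∣ J ∣ ≤ ∣ J′ ∣
    swap (p , (p<i , K-tight) , p-last)
      with spare-element {F} {K} saturated (≤-trans (∣[p∩∁⁅x⁆]∩q∣<∣p∩q∣ e∈J e∈Si) (indepJ i)) p<i K-tight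
    ... | a , a∈F , a∈Si , a∉Sp , a∉K =
      K ∪ ⁅ a ⁆ , K∪a⊆F , ∪⁅x⁆-independent S {K} {a} (independent-⊆ S (p∩q⊆p J (∁ ⁅ e ⁆)) indepJ) room ,
      ≤-trans (∣p∣≤1+∣p∩∁⁅x⁆∣ J e) (≤-reflexive (sym (x∉p⇒∣p∪⁅x⁆∣≡1+∣p∣ a∉K)))
      where
      K∪a⊆F : K ∪ ⁅ a ⁆ ⊆ F
      K∪a⊆F x∈ = [ K⊆F , (λ x∈⁅a⁆ → subst (_∈ F) (sym (x∈⁅y⁆⇒x≡y a x∈⁅a⁆)) a∈F) ]′ (x∈p∪q⁻ K ⁅ a ⁆ x∈)
      room : ∀ j → a ∈ S j → ∣ K ∩ S j ∣ < toℕ j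
      room j a∈Sj with toℕ i ≤? toℕ j | toℕ p <? toℕ j
      ... | yes i≤j | _       = ≤-trans (∣[p∩∁⁅x⁆]∩q∣<∣p∩q∣ e∈J (S-mono i≤j e∈Si)) (indepJ j)
      ... | no i≰j  | yes p<j = ≰⇒> (λ j≤∣K∩Sj∣ → p-last j p<j (≰⇒> i≰j , j≤∣K∩Sj∣))
      ... | no _    | no p≮j  = ⊥-elim (a∉Sp (S-mono (≮⇒≥ p≮j) a∈Sj))

  saturated⇒dominated : ∀ {F i e} → Saturates F i → e ∈ S i → Dominated S (F ∪ ⁅ e ⁆) F
  saturated⇒dominated {F} {i} {e} saturated e∈Si J J⊆F∪e indepJ with e ∈? J
  ... | yes e∈J = exchange saturated e∈Si e∈J J⊆F∪e indepJ
  ... | no e∉J  = J , J⊆F , indepJ , ≤-refl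
    where
    J⊆F : J ⊆ F
    J⊆F x∈J = [ id , (λ x∈⁅e⁆ → ⊥-elim (e∉J (subst (_∈ J) (x∈⁅y⁆⇒x≡y e x∈⁅e⁆) x∈J))) ]′ (x∈p∪q⁻ F ⁅ e ⁆ (J⊆F∪e x∈J))

  closed∧saturated⇒S⊆ : ∀ {F i} → IsClosed S F → Saturates F i → S i ⊆ F
  closed∧saturated⇒S⊆ closed saturated e∈Si =
    closed⇒∈ S closed (dominated⇒rank≤ S (saturated⇒dominated saturated e∈Si))

  ∣F∩S∣≡∣S∣+∣[F∩∁S]∩S∣ : ∀ {F m j} → S m ⊆ F → toℕ m ≤ toℕ j →
                         ∣ F ∩ S j ∣ ≡ ∣ S m ∣ + ∣ (F ∩ ∁ (S m)) ∩ S j ∣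
  ∣F∩S∣≡∣S∣+∣[F∩∁S]∩S∣ {F} {m} {j} Sm⊆F m≤j = trans (∣p∩r∣≡∣p∩q∣+∣p∩[r∩∁q]∣ F (S-mono m≤j))
    (cong₂ _+_ (cong ∣_∣ (q⊆p⇒p∩q≡q Sm⊆F))
               (cong ∣_∣ (trans (cong (F ∩_) (∩-comm (S j) (∁ (S m)))) (sym (∩-assoc F (∁ (S m)) (S j))))))

  dense⇒saturated : ∀ {F m i} → S m ⊆ F → toℕ m < toℕ i →
                    (∀ j → toℕ m < toℕ j → toℕ j < toℕ i → ∣ (F ∩ ∁ (S m)) ∩ S j ∣ < toℕ j ∸ toℕ m) →
                    toℕ i ∸ toℕ m ≤ ∣ (F ∩ ∁ (S m)) ∩ S i ∣ → Saturates F i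
  dense⇒saturated {F} {m} {i} Sm⊆F m<i sparse-below dense p p<i = by-cases (toℕ p ≤? toℕ m)
    where
    open ≤-Reasoning
    A : Subset n
    A = F ∩ ∁ (S m)
    i≤m+a : toℕ i ≤ toℕ m + ∣ A ∩ S i ∣
    i≤m+a = ≤-trans (m≤n+m∸n (toℕ i) (toℕ m)) (+-monoʳ-≤ (toℕ m) dense)
    by-cases : Dec (toℕ p ≤ toℕ m) → ∣ F ∩ S p ∣ + toℕ i ≤ ∣ F ∩ S i ∣ + toℕ p
    by-cases (yes p≤m) = begin
      ∣ F ∩ S p ∣ + toℕ i                   ≡⟨ cong (λ X → ∣ X ∣ + toℕ i) (q⊆p⇒p∩q≡q (Sm⊆F ∘ S-mono p≤m)) ⟩
      ∣ S p ∣ + toℕ i                       ≤⟨ +-monoʳ-≤ ∣ S p ∣ i≤m+a ⟩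
      ∣ S p ∣ + (toℕ m + ∣ A ∩ S i ∣)       ≡⟨ +-assoc (∣ S p ∣) (toℕ m) (∣ A ∩ S i ∣) ⟨
      (∣ S p ∣ + toℕ m) + ∣ A ∩ S i ∣       ≤⟨ +-monoˡ-≤ ∣ A ∩ S i ∣ (∣S∣-gap p≤m) ⟩
      (∣ S m ∣ + toℕ p) + ∣ A ∩ S i ∣       ≡⟨ xy∙z≈xz∙y (∣ S m ∣) (toℕ p) (∣ A ∩ S i ∣) ⟩
      (∣ S m ∣ + ∣ A ∩ S i ∣) + toℕ p       ≡⟨ cong (_+ toℕ p) (∣F∩S∣≡∣S∣+∣[F∩∁S]∩S∣ Sm⊆F (<⇒≤ m<i)) ⟨
      ∣ F ∩ S i ∣ + toℕ p                   ∎
    by-cases (no p≰m) = begin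
      ∣ F ∩ S p ∣ + toℕ i                                ≡⟨ cong (_+ toℕ i) (∣F∩S∣≡∣S∣+∣[F∩∁S]∩S∣ Sm⊆F (<⇒≤ m<p)) ⟩
      (∣ S m ∣ + ∣ A ∩ S p ∣) + toℕ i                    ≤⟨ +-monoʳ-≤ (∣ S m ∣ + ∣ A ∩ S p ∣) i≤m+a ⟩
      (∣ S m ∣ + ∣ A ∩ S p ∣) + (toℕ m + ∣ A ∩ S i ∣)    ≡⟨ cong ((∣ S m ∣ + ∣ A ∩ S p ∣) +_) (+-comm (toℕ m) _) ⟩
      (∣ S m ∣ + ∣ A ∩ S p ∣) + (∣ A ∩ S i ∣ + toℕ m)    ≡⟨ interchange (∣ S m ∣) (∣ A ∩ S p ∣) (∣ A ∩ S i ∣) (toℕ m) ⟩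
      (∣ S m ∣ + ∣ A ∩ S i ∣) + (∣ A ∩ S p ∣ + toℕ m)    ≤⟨ +-monoʳ-≤ (∣ S m ∣ + ∣ A ∩ S i ∣) (<⇒≤ a+m<p) ⟩
      (∣ S m ∣ + ∣ A ∩ S i ∣) + toℕ p                    ≡⟨ cong (_+ toℕ p) (∣F∩S∣≡∣S∣+∣[F∩∁S]∩S∣ Sm⊆F (<⇒≤ m<i)) ⟨
      ∣ F ∩ S i ∣ + toℕ p                                ∎
      where
      m<p : toℕ m < toℕ p
      m<p = ≰⇒> p≰m
      a+m<p : ∣ A ∩ S p ∣ + toℕ m < toℕ p
      a+m<p = m≤o∸n⇒m+n≤o (suc ∣ A ∩ S p ∣) (<⇒≤ m<p) (sparse-below p m<p p<i)

  closed⇒A∪S : ∀ {F} → IsClosed S F →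
               Σ (Fin (suc r)) λ m → Σ (Subset n) λ A →
                 A ⊆ ∁ (S m) × (∀ i → toℕ m < toℕ i → ∣ A ∩ S i ∣ < toℕ i ∸ toℕ m) × F ≡ A ∪ S m
  closed⇒A∪S {F} closed with greatest (λ j → S j ⊆? F) {Fin.zero} (closed∧saturated⇒S⊆ {i = Fin.zero} closed (λ _ ()))
  ... | m , Sm⊆F , m-last =
    m , F ∩ ∁ (S m) , p∩q⊆q F (∁ (S m)) , (λ i → sparse-from i (<-wellFounded i)) , sym (q⊆p⇒[p∩∁q]∪q≡p Sm⊆F)
    where
    sparse-from : ∀ i → Acc Fin._<_ i → toℕ m < toℕ i → ∣ (F ∩ ∁ (S m)) ∩ S i ∣ < toℕ i ∸ toℕ m
    sparse-from i (acc below) m<i with ∣ (F ∩ ∁ (S m)) ∩ S i ∣ <? toℕ i ∸ toℕ m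
    ... | yes sparse = sparse
    ... | no dense   = ⊥-elim (m-last i m<i (closed∧saturated⇒S⊆ closed
            (dense⇒saturated Sm⊆F m<i (λ j m<j j<i → sparse-from j (below j<i) m<j) (≮⇒≥ dense))))

proposition5p5 : (n r : ℕ) (S : Fin (suc r) → Subset n) → IsFlag S →
  (F : Subset n) →
  (IsClosed S F ⇔
    Σ (Fin (suc r)) (λ m → Σ (Subset n) (λ A →
      A ⊆ ∁ (S m) ×
      ((i : Fin (suc r)) → toℕ m < toℕ i → ∣ A ∩ S i ∣ < toℕ i ∸ toℕ m) ×
      F ≡ A ∪ S m)))
  × ((m : Fin (suc r)) (A : Subset n) →
      A ⊆ ∁ (S m) →
      ((i : Fin (suc r)) → toℕ m < toℕ i → ∣ A ∩ S i ∣ < toℕ i ∸ toℕ m) →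
      F ≡ A ∪ S m →
      rank S F ≡ toℕ m + ∣ A ∣)
proposition5p5 n r S flag F =
  mk⇔ closed⇒A∪S (λ (_ , _ , A⊆∁Sm , sparse , F≡A∪Sm) → subst (IsClosed S) (sym F≡A∪Sm) (A∪S-closed A⊆∁Sm sparse)) ,
  λ _ _ A⊆∁Sm sparse F≡A∪Sm → trans (cong (rank S) F≡A∪Sm) (rank[A∪S]≡ A⊆∁Sm (λ i m<i → <⇒≤ (sparse i m<i)))
  where open FreedomMatroid flag
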